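{- If $S\subseteq\mathbb{N}^{\mathbb{N}}$ is overguessable, then $S$ is defined by some sentence $\exists x\,\forall y\,\phi$ of $\mathscr{L}_{\max}$ with $\phi$ quantifier-free.
   Context: $\mathbb{N}^{<\mathbb{N}}$ is the set of finite sequences of naturals. $S\subseteq\mathbb{N}^{\mathbb{N}}$ is overguessable if there is $\mu:\mathbb{N}^{<\mathbb{N}}\to\mathbb{N}\cup\{\infty\}$ such that (1) for every $f\in S$, the values $\mu(f(0),\ldots,f(n))$ are bounded by a finite number for all sufficiently large $n$, and (2) for every $f\notin S$, $\mu(f(0),\ldots,f(n))\to\infty$ as $n\to\infty$. The language $\mathscr{L}_{\max}$ consists of: equality, connectives and quantifiers; a constant symbol $\mathbf{n}$ for each $n\in\mathbb{N}$; an $n$-ary function symbol $\tilde w$ for each $w:\mathbb{N}^n\to\mathbb{N}$ ($n>0$); an $n$-ary predicate symbol $\tilde p$ for each $p\subseteq\mathbb{N}^n$ ($n>0$); an "$\mathbb{N}^{<\mathbb{N}}$-ary" function symbol $\tilde G$ for each $G:\mathbb{N}^{<\mathbb{N}}\to\mathbb{N}$; a unary function symbol $\mathbf{f}$; and a symbol $\cdots_x$ for each variable $x$. Terms: variables; constants; $h(t_1,\ldots,t_n)$ for an $n$-ary or $\mathbb{N}^{<\mathbb{N}}$-ary symbol $h$; and, for $\mathbb{N}^{<\mathbb{N}}$-ary $G$, terms $u,v$, variable $x$, the term $G(u(\mathbf{0}),\cdots_x,u(v))$ with free variables $(FV(u)\setminus\{x\})\cup FV(v)$. Formulas as in first-order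 logic. For $f:\mathbb{N}\to\mathbb{N}$, $\mathscr{M}_f$ has universe $\mathbb{N}$ and interprets $\mathbf n$ as $n$ (numeral $\bar n$), $\tilde w$ as $w$, $\tilde p$ as $p$, $\tilde G$ as $G$, $\mathbf f$ as $f$; terms are evaluated under an assignment $s$ by the usual recursion plus $G(u(\mathbf 0),\cdots_x,u(v))^s=G\big(u(x|\mathbf 0)^s,\ldots,u(x|\overline{v^s})^s\big)$; satisfaction is as usual. A sentence $\phi$ defines $S$ if for every $f:\mathbb{N}\to\mathbb{N}$, $\mathscr{M}_f\models\phi$ iff $f\in S$. -}

module Defs where

open import Data.Nat using (ℕ; zero; suc; _≤_; _<_)
open import Data.Bool using (Bool; true; false)
open import Data.List using (List; map; upTo)
open import Data.Vec using (Vec; []; _∷_)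
open import Data.Product using (Σ; ∃; _×_; _,_)
open import Data.Sum using (_⊎_)
open import Data.Empty using (⊥)
open import Data.Unit using (⊤)
open import Relation.Nullary using (¬_)
open import Relation.Binary.PropositionalEquality using (_≡_; _≢_)
open import Relation.Nullary.Decidable using (⌊_⌋)
open import Data.Nat using (_≟_)

-- Subsets of ℕ^ℕ and of ℕ^n are given by characteristic functions
-- (classically every subset has one).

Seq : Set
Seq = List ℕ

prefix : (ℕ → ℕ) → ℕ → Seq
prefix f n = map f (upTo (suc n))

data ℕ∞ : Set where
  fin : ℕ → ℕ∞
  ∞   : ℕ∞

infix 4 _≤∞_ _<∞_
data _≤∞_ : ℕ∞ → ℕ → Set where
  fin≤ : ∀ {m B} → m ≤ B → fin m ≤∞ B

data _<∞_ : ℕ → ℕ∞ → Set where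
  <fin : ∀ {m B} → B < m → B <∞ fin m
  <inf : ∀ {B} → B <∞ ∞

Overguessable : ((ℕ → ℕ) → Bool) → Set
Overguessable S =
  Σ (Seq → ℕ∞) λ μ →
    ((f : ℕ → ℕ) → S f ≡ true →
       Σ ℕ λ B → Σ ℕ λ N → (n : ℕ) → N ≤ n → μ (prefix f n) ≤∞ B)
  × ((f : ℕ → ℕ) → S f ≡ false →
       (B : ℕ) → Σ ℕ λ N → (n : ℕ) → N ≤ n → B <∞ μ (prefix f n))

Var : Set
Var = ℕ

data Term : Set where
  var   : Var → Term
  const : ℕ → Term
  fun   : (k : ℕ) → (Vec ℕ (suc k) → ℕ) → Vec Term (suc k) → Term
  fsym  : Term → Term
  gapp  : (n : ℕ) → (Seq → ℕ) → Vec Term n → Term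
  gbig  : (Seq → ℕ) → Term → Var → Term → Term                  -- G̃(u(𝟎),⋯ₓ,u(v)) as gbig G u x v

data Formula : Set where
  _≐_  : Term → Term → Formula
  rel  : (k : ℕ) → (Vec ℕ (suc k) → Bool) → Vec Term (suc k) → Formula
  ⊥f   : Formula
  ¬f_  : Formula → Formula
  _∧f_ : Formula → Formula → Formula
  _∨f_ : Formula → Formula → Formula
  _⇒f_ : Formula → Formula → Formula
  ∀f   : Var → Formula → Formula
  ∃f   : Var → Formula → Formula

data QuantifierFree : Formula → Set where
  qf-eq  : ∀ {t u} → QuantifierFree (t ≐ u)
  qf-rel : ∀ {k p ts} → QuantifierFree (rel k p ts)
  qf-⊥   : QuantifierFree ⊥f
  qf-¬   : ∀ {φ} → QuantifierFree φ → QuantifierFree (¬f φ)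
  qf-∧   : ∀ {φ ψ} → QuantifierFree φ → QuantifierFree ψ → QuantifierFree (φ ∧f ψ)
  qf-∨   : ∀ {φ ψ} → QuantifierFree φ → QuantifierFree ψ → QuantifierFree (φ ∨f ψ)
  qf-⇒   : ∀ {φ ψ} → QuantifierFree φ → QuantifierFree ψ → QuantifierFree (φ ⇒f ψ)

mutual
  FreeT : Var → Term → Set
  FreeT z (var y)        = z ≡ y
  FreeT z (const _)      = ⊥
  FreeT z (fun k w ts)   = FreeTs z ts
  FreeT z (fsym t)       = FreeT z t
  FreeT z (gapp n G ts)  = FreeTs z ts
  FreeT z (gbig G u x v) = (FreeT z u × z ≢ x) ⊎ FreeT z v

  FreeTs : ∀ {n} → Var → Vec Term n → Set
  FreeTs z []       = ⊥
  FreeTs z (t ∷ ts) = FreeT z t ⊎ FreeTs z ts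

FreeF : Var → Formula → Set
FreeF z (t ≐ u)      = FreeT z t ⊎ FreeT z u
FreeF z (rel k p ts) = FreeTs z ts
FreeF z ⊥f           = ⊥
FreeF z (¬f φ)       = FreeF z φ
FreeF z (φ ∧f ψ)     = FreeF z φ ⊎ FreeF z ψ
FreeF z (φ ∨f ψ)     = FreeF z φ ⊎ FreeF z ψ
FreeF z (φ ⇒f ψ)     = FreeF z φ ⊎ FreeF z ψ
FreeF z (∀f x φ)     = FreeF z φ × z ≢ x
FreeF z (∃f x φ)     = FreeF z φ × z ≢ x

Sentence : Formula → Set
Sentence φ = (z : Var) → ¬ FreeF z φ

Assignment : Set
Assignment = Var → ℕ

_[_↦_] : Assignment → Var → ℕ → Assignment
(s [ x ↦ a ]) y with ⌊ y ≟ x ⌋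
... | true  = a
... | false = s y

-- u(x|n̄)^s is evaluated as u^{s(x|n)} (the numeral n̄ is closed, so the
-- substitution lemma makes these equal by definition of the semantics).
mutual
  eval : (ℕ → ℕ) → Assignment → Term → ℕ
  eval f s (var x)        = s x
  eval f s (const n)      = n
  eval f s (fun k w ts)   = w (evals f s ts)
  eval f s (fsym t)       = f (eval f s t)
  eval f s (gapp n G ts)  = G (Data.Vec.toList (evals f s ts))
  eval f s (gbig G u x v) = G (map (λ i → eval f (s [ x ↦ i ]) u) (upTo (suc (eval f s v))))

  evals : ∀ {n} → (ℕ → ℕ) → Assignment → Vec Term n → Vec ℕ n
  evals f s []       = []
  evals f s (t ∷ ts) = eval f s t ∷ evals f s ts

Sat : (ℕ → ℕ) → Assignment → Formula → Set
Sat f s (t ≐ u)      = eval f s t ≡ eval f s u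
Sat f s (rel k p ts) = p (evals f s ts) ≡ true
Sat f s ⊥f           = ⊥
Sat f s (¬f φ)       = ¬ Sat f s φ
Sat f s (φ ∧f ψ)     = Sat f s φ × Sat f s ψ
Sat f s (φ ∨f ψ)     = Sat f s φ ⊎ Sat f s ψ
Sat f s (φ ⇒f ψ)     = Sat f s φ → Sat f s ψ
Sat f s (∀f x φ)     = (a : ℕ) → Sat f (s [ x ↦ a ]) φ
Sat f s (∃f x φ)     = Σ ℕ λ a → Sat f (s [ x ↦ a ]) φ

-- 𝓜_f ⊨ φ  (for sentences, independent of the assignment)
_⊨_ : (ℕ → ℕ) → Formula → Set
f ⊨ φ = (s : Assignment) → Sat f s φ

Defines : Formula → ((ℕ → ℕ) → Bool) → Set
Defines φ S = (f : ℕ → ℕ) → ((f ⊨ φ) → S f ≡ true) × (S f ≡ true → f ⊨ φ)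

module Submission where

-- Let μ witness that S is overguessable.  Call a sequence
-- g : ℕ → ℕ∞ self-bounded if some K satisfies g n ≤ K for every n ≥ K.
-- Eventually bounded sequences are self-bounded (take K = max(B, N)),
-- while sequences tending to ∞ are not (at n = max(N, K) the value
-- exceeds K).  Hence f ∈ S iff n ↦ μ(f(0),…,f(n)) is self-bounded.
--
-- Self-boundedness is an ∃K ∀n statement, and its matrix is
-- quantifier-free in L_max: coding ℕ∞ into ℕ (∞ ↦ 0, m ↦ m+1) turns μ
-- into a symbol G̃, the prefix μ(f(0),…,f(n)) becomes the term
-- G̃(𝐟(z)(𝟎),⋯_z,𝐟(z)(n)), and "K ≤ n" and "the decoded value is ≤ K"
-- are binary predicate symbols.

open import Defs
open import Data.Nat using (ℕ; zero; suc; _≤_; _≤ᵇ_; _⊔_)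
open import Data.Nat.Properties
  using (≤ᵇ⇒≤; ≤⇒≤ᵇ; m≤m⊔n; m≤n⊔m; ≤-trans; <-≤-trans; <-irrefl)
open import Data.Bool using (Bool; true; false)
open import Data.Bool.Properties using (T-≡)
open import Data.Product using (Σ; _×_; _,_)
open import Data.Sum using (inj₁; inj₂)
open import Data.Empty using (⊥-elim)
open import Data.Vec using (Vec; []; _∷_)
open import Function.Bundles using (Equivalence)
open import Relation.Nullary using (¬_)
open import Relation.Binary.PropositionalEquality using (_≡_; refl)

-- Boolean comparison of naturals, read as an equation with true (the
-- form in which predicate symbols are interpreted).
≤ᵇ-true⇒≤ : ∀ m n → (m ≤ᵇ n) ≡ true → m ≤ n
≤ᵇ-true⇒≤ m n e = ≤ᵇ⇒≤ m n (Equivalence.from T-≡ e)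

≤⇒≤ᵇ-true : ∀ {m n} → m ≤ n → (m ≤ᵇ n) ≡ true
≤⇒≤ᵇ-true m≤n = Equivalence.to T-≡ (≤⇒≤ᵇ m≤n)

≤∞-weaken : ∀ {x B C} → B ≤ C → x ≤∞ B → x ≤∞ C
≤∞-weaken B≤C (fin≤ m≤B) = fin≤ (≤-trans m≤B B≤C)

<∞⇒≰∞ : ∀ {x B} → B <∞ x → ¬ (x ≤∞ B)
<∞⇒≰∞ (<fin B<m) (fin≤ m≤B) = <-irrefl refl (<-≤-trans B<m m≤B)

EventuallyBounded : (ℕ → ℕ∞) → Set
EventuallyBounded g = Σ ℕ λ B → Σ ℕ λ N → (n : ℕ) → N ≤ n → g n ≤∞ B

Diverges : (ℕ → ℕ∞) → Set
Diverges g = (B : ℕ) → Σ ℕ λ N → (n : ℕ) → N ≤ n → B <∞ g n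

SelfBounded : (ℕ → ℕ∞) → Set
SelfBounded g = Σ ℕ λ K → (n : ℕ) → K ≤ n → g n ≤∞ K

-- A single threshold K = max(B, N) serves both as start and as bound.
eventuallyBounded⇒selfBounded : ∀ g → EventuallyBounded g → SelfBounded g
eventuallyBounded⇒selfBounded g (B , N , bounded) =
  B ⊔ N , λ n K≤n →
    ≤∞-weaken (m≤m⊔n B N) (bounded n (≤-trans (m≤n⊔m B N) K≤n))

-- At n = max(N, K) a divergent sequence exceeds K, contradicting K.
diverges⇒¬selfBounded : ∀ g → Diverges g → ¬ SelfBounded g
diverges⇒¬selfBounded g diverges (K , selfBounded) with diverges K
... | N , above = <∞⇒≰∞ (above n (m≤m⊔n N K)) (selfBounded n (m≤n⊔m N K))
  where n = N ⊔ K

-- Coding ℕ ∪ {∞} into ℕ, so that μ becomes a function symbol.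
code : ℕ∞ → ℕ
code (fin m) = suc m
code ∞       = zero

codeAtMost : Vec ℕ 2 → Bool
codeAtMost (K ∷ zero  ∷ []) = false
codeAtMost (K ∷ suc m ∷ []) = m ≤ᵇ K

codeAtMost-sound : ∀ K x → codeAtMost (K ∷ code x ∷ []) ≡ true → x ≤∞ K
codeAtMost-sound K (fin m) e = fin≤ (≤ᵇ-true⇒≤ m K e)
codeAtMost-sound K ∞ ()

codeAtMost-complete : ∀ {K x} → x ≤∞ K → codeAtMost (K ∷ code x ∷ []) ≡ true
codeAtMost-complete (fin≤ m≤K) = ≤⇒≤ᵇ-true m≤K

atMost : Vec ℕ 2 → Bool
atMost (a ∷ b ∷ []) = a ≤ᵇ b

module SelfBoundedSentence (μ : Seq → ℕ∞) where

  -- μ(f(0),…,f(x₁)), coded; under s it evaluates to code (μ (prefix f (s 1)))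
  -- by definition, which is why the lemmas below need no rewriting.
  guess : Term
  guess = gbig (λ σ → code (μ σ)) (fsym (var 2)) 2 (var 1)

  matrix : Formula
  matrix = rel 1 atMost (var 0 ∷ var 1 ∷ []) ⇒f rel 1 codeAtMost (var 0 ∷ guess ∷ [])

  matrix-qf : QuantifierFree matrix
  matrix-qf = qf-⇒ qf-rel qf-rel

  sentence : Formula
  sentence = ∃f 0 (∀f 1 matrix)

  -- x₀ and x₁ are bound by the quantifiers and x₂ by the ⋯ binder.
  sentence-closed : Sentence sentence
  sentence-closed z ((inj₁ (inj₁ refl) , z≢1) , z≢0)                      = z≢0 refl
  sentence-closed z ((inj₁ (inj₂ (inj₁ refl)) , z≢1) , z≢0)               = z≢1 refl
  sentence-closed z ((inj₁ (inj₂ (inj₂ ())) , z≢1) , z≢0)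
  sentence-closed z ((inj₂ (inj₁ refl) , z≢1) , z≢0)                      = z≢0 refl
  sentence-closed z ((inj₂ (inj₂ (inj₁ (inj₁ (refl , z≢2)))) , z≢1) , z≢0) = z≢2 refl
  sentence-closed z ((inj₂ (inj₂ (inj₁ (inj₂ refl))) , z≢1) , z≢0)        = z≢1 refl
  sentence-closed z ((inj₂ (inj₂ (inj₂ ())) , z≢1) , z≢0)

  guesses : (ℕ → ℕ) → ℕ → ℕ∞
  guesses f n = μ (prefix f n)

  sat⇒selfBounded : ∀ f s → Sat f s sentence → SelfBounded (guesses f)
  sat⇒selfBounded f s (K , holds) =
    K , λ n K≤n → codeAtMost-sound K (guesses f n) (holds n (≤⇒≤ᵇ-true K≤n))

  selfBounded⇒sat : ∀ f s → SelfBounded (guesses f) → Sat f s sentence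
  selfBounded⇒sat f s (K , bounded) =
    K , λ n K≤ᵇn → codeAtMost-complete (bounded n (≤ᵇ-true⇒≤ K n K≤ᵇn))

proposition9 : (S : (ℕ → ℕ) → Bool) → Overguessable S →
    Σ Var λ x → Σ Var λ y → Σ Formula λ φ →
      QuantifierFree φ × Sentence (∃f x (∀f y φ)) × Defines (∃f x (∀f y φ)) S
proposition9 S (μ , bounded-on-S , diverges-off-S) =
  0 , 1 , matrix , matrix-qf , sentence-closed , λ f → sound f , complete f
  where
  open SelfBoundedSentence μ

  sound : ∀ f → f ⊨ sentence → S f ≡ true
  sound f holds with S f in S-f
  ... | true  = refl
  ... | false = ⊥-elim (diverges⇒¬selfBounded (guesses f) (diverges-off-S f S-f)
                          (sat⇒selfBounded f (λ _ → 0) (holds (λ _ → 0))))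

  complete : ∀ f → S f ≡ true → f ⊨ sentence
  complete f f∈S s = selfBounded⇒sat f s
    (eventuallyBounded⇒selfBounded (guesses f) (bounded-on-S f f∈S))
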